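{- Let $\Delta$ be a positive integer. Every graph with no induced $\Delta$-star has a spanning $\Delta$-forest.
   Context: Graphs are finite, undirected and unweighted. Vertices $v_0,\dots,v_k$ form an induced $k$-star centered at $v_0$ if $v_0$ is adjacent to each $v_i$ ($i\in[k]$) and no two of $v_1,\dots,v_k$ are adjacent. A spanning forest of $G$ is a forest subgraph on vertex set $V(G)$ with the same connected components as $G$; a spanning $\Delta$-forest is a spanning forest in which every vertex has degree at most $\Delta$. -}

module Defs where

open import Data.Nat using (ℕ; _≤_)
open import Data.Bool using (Bool; T)
open import Data.Fin using (Fin)
open import Data.List using (List; []; _∷_; _++_; [_]; length; filter)
open import Data.List.Relation.Unary.Unique.Propositional using (Unique)
open import Data.List.Relation.Unary.Linked using (Linked)
open import Data.Fin.Base using () 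
open import Data.List using (allFin)
open import Data.Product using (Σ; ∃; _×_; _,_)
open import Relation.Nullary using (¬_)
open import Relation.Binary.PropositionalEquality using (_≡_)
open import Relation.Binary.Construct.Closure.ReflexiveTransitive using (Star)
open import Relation.Nullary.Decidable using (does)
open import Function using (_⇔_)

record Graph (n : ℕ) : Set where
  field
    adj    : Fin n → Fin n → Bool
    sym    : ∀ u v → adj u v ≡ adj v u
    irrefl : ∀ v → adj v v ≡ Bool.false

open Graph public

Adj : ∀ {n} → Graph n → Fin n → Fin n → Set
Adj G u v = T (adj G u v)

InducedStar : ∀ {n} → Graph n → ℕ → Set
InducedStar {n} G k =
  Σ (Fin n) λ c → Σ (Fin k → Fin n) λ leaf →
    (∀ i j → leaf i ≡ leaf j → i ≡ j) ×
    (∀ i → Adj G c (leaf i)) ×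
    (∀ i j → ¬ Adj G (leaf i) (leaf j))

Subgraph : ∀ {n} → Graph n → Graph n → Set
Subgraph {n} H G = ∀ (u v : Fin n) → Adj H u v → Adj G u v

Connected : ∀ {n} → Graph n → Fin n → Fin n → Set
Connected G = Star (Adj G)

HasCycle : ∀ {n} → Graph n → Set
HasCycle {n} G =
  Σ (Fin n) λ v → Σ (List (Fin n)) λ vs →
    (2 ≤ length vs) × Unique (v ∷ vs) × Linked (Adj G) (v ∷ vs ++ [ v ])

Forest : ∀ {n} → Graph n → Set
Forest G = ¬ HasCycle G

degree : ∀ {n} → Graph n → Fin n → ℕ
degree {n} G v = length (filter (λ u → Data.Bool._≟_ (adj G v u) Bool.true) (allFin n))
  where import Data.Bool

SpanningForest : ∀ {n} → Graph n → Graph n → Set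
SpanningForest {n} G F =
  Subgraph F G × Forest F × (∀ (u v : Fin n) → Connected G u v ⇔ Connected F u v)

SpanningΔForest : ∀ {n} → ℕ → Graph n → Graph n → Set
SpanningΔForest Δ G F = SpanningForest G F × (∀ v → degree F v ≤ Δ)

{-# OPTIONS --safe #-}
module Submission where

-- Order the vertices by a graph search, so that every vertex other than the first of its
-- component has an earlier neighbour, and join each such vertex to its latest earlier
-- neighbour. Parents are earlier and unique, so these edges form a forest, and following
-- parents from any vertex ends at the first vertex of its component, so the forest spans.
-- Two children c₁, c₂ of v, with c₁ visited first, are not adjacent: otherwise c₁ rather
-- than v would be the latest earlier neighbour of c₂. So if v had forest degree above Δ,
-- discarding its parent would leave Δ pairwise non-adjacent children, an induced Δ-star.

open import Defs using (Graph; Adj; adj; Connected; degree; InducedStar; Subgraph; Forest; SpanningΔForest)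
open import Data.Bool using (Bool; true; T; _∨_)
import Data.Bool as Bool
open import Data.Bool.Properties using (∨-comm; ∨-idem; T-∨)
open import Data.Fin using (Fin; _≟_; punchIn; inject≤)
import Data.Fin.Properties as Finₚ
open import Data.List using (List; []; _∷_; _++_; [_]; _∷ʳ_; length; filter; allFin; lookup; initLast; _∷ʳ′_)
open import Data.List.Extrema.Nat using (argmax; argmax-all; f[xs]≤f[argmax])
open import Data.List.Membership.Propositional using (_∈_; _∉_; find; lose)
open import Data.List.Membership.Propositional.Properties using (∈-++⁺ʳ; ∈-allFin; ∈-filter⁺; ∈-filter⁻; ∈-lookup)
open import Data.List.Relation.Unary.All as All using (All; []; _∷_)
open import Data.List.Relation.Unary.All.Properties using (all-filter; ¬Any⇒All¬)
open import Data.List.Relation.Unary.AllPairs using ([]; _∷_)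
open import Data.List.Relation.Unary.Any using (Any; here; there; any?)
open import Data.List.Relation.Unary.Linked as Linked using (Linked; [-]; _∷_)
open import Data.List.Relation.Unary.Linked.Properties using (Linked⇒AllPairs)
open import Data.List.Relation.Unary.Unique.Propositional using (Unique)
import Data.List.Relation.Unary.Unique.Propositional.Properties as Unique
open import Data.Nat using (ℕ; zero; suc; _≤_; _<_; z≤n; s≤s; _<?_; _≤?_)
open import Data.Nat.Induction using (<-wellFounded)
open import Data.Nat.Properties
  using (module ≤-Reasoning; ≤-refl; ≤-antisym; <-trans; <-irrefl; <-asym; <-cmp; <-≤-trans; n<1+n; <⇒≤; ≰⇒>; <⇒≱)
open import Data.Product using (Σ; ∃; ∃₂; _×_; _,_; proj₁; proj₂)
open import Data.Sum as Sum using (_⊎_; inj₁; inj₂)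
open import Data.Unit using (⊤)
open import Function using (_∘_; _on_; flip; mk⇔; Equivalence)
open import Induction.WellFounded using (Acc; acc)
import Relation.Binary.Construct.On as On
open import Relation.Binary using (Rel; Transitive)
open import Relation.Binary.Construct.Closure.ReflexiveTransitive as Star using (Star; ε; _◅_; _◅◅_)
open import Relation.Binary.Definitions using (tri<; tri≈; tri>)
open import Relation.Binary.PropositionalEquality using (_≡_; _≢_; refl; sym; trans; cong; subst; module ≡-Reasoning)
open import Relation.Nullary using (¬_; Dec; yes; no; ¬?; contradiction; isYes)
open import Relation.Nullary.Decidable
  using (_×-dec_; _→-dec_; T?; decidable-stable; dec-false; isYes≗does; toWitness; fromWitness)

module _ {A : Set} where

  NonBacktracking : List A → Set
  NonBacktracking (x ∷ y ∷ z ∷ l) = x ≢ z × NonBacktracking (y ∷ z ∷ l)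
  NonBacktracking _               = ⊤

  unique⇒nonBacktracking : ∀ {xs} → Unique xs → NonBacktracking xs
  unique⇒nonBacktracking {[]}              _                  = _
  unique⇒nonBacktracking {_ ∷ []}          _                  = _
  unique⇒nonBacktracking {_ ∷ _ ∷ []}      _                  = _
  unique⇒nonBacktracking {_ ∷ _ ∷ _ ∷ _} ((_ ∷ x≢z ∷ _) ∷ u) = x≢z , unique⇒nonBacktracking u

  nonBacktracking-tail : ∀ {x xs} → NonBacktracking (x ∷ xs) → NonBacktracking xs
  nonBacktracking-tail {xs = []}        _        = _
  nonBacktracking-tail {xs = _ ∷ []}    _        = _
  nonBacktracking-tail {xs = _ ∷ _ ∷ _} (_ , nb) = nb

  unique-∷ʳ : ∀ {xs : List A} {v} → Unique xs → v ∉ xs → Unique (xs ∷ʳ v)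
  unique-∷ʳ u v∉xs = Unique.++⁺ u ([] ∷ []) λ { (v∈xs , here refl) → v∉xs v∈xs }

  closed-walk-nonBacktracking : ∀ {v x y l} → Unique (v ∷ x ∷ y ∷ l) →
                                NonBacktracking (v ∷ x ∷ y ∷ l ∷ʳ v)
  closed-walk-nonBacktracking (v∉ ∷ u) =
    All.lookup v∉ (there (here refl)) ,
    unique⇒nonBacktracking (unique-∷ʳ u λ v∈ → All.lookup v∉ v∈ refl)

  member≢ : ∀ {x y : A} {xs} → All (x ≢_) xs → y ∈ xs → y ≢ x
  member≢ x∉ y∈ y≡x = All.lookup x∉ y∈ (sym y≡x)

  last-link : ∀ {ℓ} {R : Rel A ℓ} w {y z} → Linked R (w ∷ʳ y ∷ʳ z) → R y z
  last-link []      (Ryz ∷ _) = Ryz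
  last-link (_ ∷ w) chain     = last-link w (Linked.tail chain)

  closed-chain-impossible : ∀ {ℓ} {R : Rel A ℓ} → Transitive R → (∀ {x} → ¬ R x x) →
                            ∀ {v} xs → ¬ Linked R (v ∷ xs ∷ʳ v)
  closed-chain-impossible trans irrefl xs chain with Linked⇒AllPairs trans chain
  ... | Rv ∷ _ = irrefl (All.lookup Rv (∈-++⁺ʳ xs (here refl)))

module ParentGraph {A : Set} (Parent : A → A → Set) (rank : A → ℕ)
  (parent-lower  : ∀ {c p} → Parent c p → rank p < rank c)
  (parent-unique : ∀ {c p q} → Parent c p → Parent c q → p ≡ q) where

  ParentEdge : A → A → Set
  ParentEdge a b = Parent a b ⊎ Parent b a

  parent-asym : ∀ {a b} → Parent a b → ¬ Parent b a
  parent-asym p q = <-asym (parent-lower p) (parent-lower q)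

  -- Once a non-backtracking walk steps down to a child, every later step does too:
  -- stepping back up would return to the unique parent it just came from.
  descend : ∀ {a b l} → NonBacktracking (a ∷ b ∷ l) → Linked ParentEdge (a ∷ b ∷ l) →
            Parent b a → Linked (flip Parent) (a ∷ b ∷ l)
  descend {l = []}    _         _                       p = p ∷ [-]
  descend {l = _ ∷ _} (a≢c , _) (_ ∷ inj₁ q ∷ _)        p = contradiction (parent-unique p q) a≢c
  descend {l = _ ∷ _} (_ , nb)  (_ ∷ walk@(inj₂ q ∷ _)) p = p ∷ descend nb walk q

  ascend : ∀ w {y z} → NonBacktracking (w ∷ʳ y ∷ʳ z) → Linked ParentEdge (w ∷ʳ y ∷ʳ z) →
           Parent y z → Linked Parent (w ∷ʳ y ∷ʳ z)
  ascend []          _  _                 p = p ∷ [-]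
  ascend (_ ∷ [])    _  (inj₁ q ∷ _)      p = q ∷ p ∷ [-]
  ascend (a ∷ [])    nb walk@(inj₂ q ∷ _) p =
    contradiction (last-link [ a ] (descend nb walk q)) (parent-asym p)
  ascend (_ ∷ b ∷ w) nb (inj₁ q ∷ walk)   p = q ∷ ascend (b ∷ w) (nonBacktracking-tail nb) walk p
  ascend (a ∷ b ∷ w) nb walk@(inj₂ q ∷ _) p =
    contradiction (last-link (a ∷ b ∷ w) (descend nb walk q)) (parent-asym p)

  no-descending-cycle : ∀ {v} xs → ¬ Linked (flip Parent) (v ∷ xs ∷ʳ v)
  no-descending-cycle xs chain =
    closed-chain-impossible <-trans (<-irrefl refl) xs (Linked.map parent-lower chain)

  no-ascending-cycle : ∀ {v} xs → ¬ Linked Parent (v ∷ xs ∷ʳ v)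
  no-ascending-cycle xs chain =
    closed-chain-impossible (flip <-trans) (<-irrefl refl) xs (Linked.map parent-lower chain)

  -- A cycle v x … z v can neither start by descending nor end by ascending,
  -- so x and z are both the parent of v.
  no-cycle-through : ∀ {v x} vs → Unique (v ∷ x ∷ vs) → NonBacktracking (v ∷ x ∷ vs ∷ʳ v) →
                     ¬ Linked ParentEdge (v ∷ x ∷ vs ∷ʳ v)
  no-cycle-through vs uniq nb walk with initLast vs
  no-cycle-through _ _ (v≢v , _) _ | [] = v≢v refl
  no-cycle-through {v} {x} _ (_ ∷ x∉ ∷ _) nb walk | mid ∷ʳ′ z
    with Linked.head walk | last-link (v ∷ x ∷ mid) walk
  ... | inj₂ p | _      = no-descending-cycle (x ∷ mid ∷ʳ z) (descend nb walk p)
  ... | inj₁ _ | inj₁ q = no-ascending-cycle (x ∷ mid ∷ʳ z) (ascend (v ∷ x ∷ mid) nb walk q)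
  ... | inj₁ p | inj₂ q = contradiction (parent-unique p q) (All.lookup x∉ (∈-++⁺ʳ mid (here refl)))

  parent-edges-acyclic : ∀ v vs → 2 ≤ length vs → Unique (v ∷ vs) →
                         ¬ Linked ParentEdge (v ∷ vs ++ [ v ])
  parent-edges-acyclic v (_ ∷ [])    (s≤s ())
  parent-edges-acyclic v (_ ∷ y ∷ l) _ uniq =
    no-cycle-through (y ∷ l) uniq (closed-walk-nonBacktracking uniq)

unique⇒lookup-injective : ∀ {A : Set} {xs : List A} → Unique xs →
                          ∀ i j → lookup xs i ≡ lookup xs j → i ≡ j
unique⇒lookup-injective (_ ∷ _)  Fin.zero    Fin.zero    _  = refl
unique⇒lookup-injective (x∉ ∷ _) Fin.zero    (Fin.suc j) eq = contradiction eq (All.lookup x∉ (∈-lookup j))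
unique⇒lookup-injective (x∉ ∷ _) (Fin.suc i) Fin.zero    eq = contradiction (sym eq) (All.lookup x∉ (∈-lookup i))
unique⇒lookup-injective (_ ∷ u)  (Fin.suc i) (Fin.suc j) eq = cong Fin.suc (unique⇒lookup-injective u i j eq)

unique⇒length≤ : ∀ {n} {xs : List (Fin n)} → Unique xs → length xs ≤ n
unique⇒length≤ {n} {xs} u with length xs ≤? n
... | yes ≤n = ≤n
... | no  ≰n with Finₚ.pigeonhole (≰⇒> ≰n) (lookup xs)
...   | i , j , i<j , eq = contradiction (unique⇒lookup-injective u i j eq) (Finₚ.<⇒≢ i<j)

module _ {A : Set} {ℓ} {R : A → A → Set ℓ} {P : A → Set} (P? : ∀ x → Dec (P x)) where

  exit-edge : ∀ {a b} → Star R a b → P a → ¬ P b → ∃₂ λ c d → P c × ¬ P d × R c d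
  exit-edge ε          Pa ¬Pb = contradiction Pa ¬Pb
  exit-edge (_◅_ {j = m} e path) Pa ¬Pb with P? m
  ... | yes Pm = exit-edge path Pm ¬Pb
  ... | no ¬Pm = _ , _ , Pa , ¬Pm , e

-- Lists of visited vertices are kept most recent first, so visit times count from the end.
visit-time : ∀ {n} → List (Fin n) → Fin n → ℕ
visit-time []        v = 0
visit-time (x ∷ pre) v with v ≟ x
... | yes _ = length pre
... | no  _ = visit-time pre v

visit-time-here : ∀ {n} (x : Fin n) pre → visit-time (x ∷ pre) x ≡ length pre
visit-time-here x pre with x ≟ x
... | yes _   = refl
... | no  x≢x = contradiction refl x≢x

visit-time-there : ∀ {n} {x y : Fin n} {pre} → All (x ≢_) pre → y ∈ pre →
                   visit-time (x ∷ pre) y ≡ visit-time pre y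
visit-time-there {x = x} {y} x∉ y∈ with y ≟ x
... | yes y≡x = contradiction y≡x (member≢ x∉ y∈)
... | no  _   = refl

visit-time<length : ∀ {n} {v : Fin n} {s} → v ∈ s → visit-time s v < length s
visit-time<length {v = v} {x ∷ pre} v∈ with v ≟ x | v∈
... | yes _   | _          = ≤-refl
... | no  v≢x | here v≡x   = contradiction v≡x v≢x
... | no  _   | there v∈′  = <-trans (visit-time<length v∈′) (n<1+n _)

visit-time-here≢there : ∀ {n} {x w : Fin n} {pre} → All (x ≢_) pre → w ∈ pre →
                        visit-time (x ∷ pre) x ≢ visit-time (x ∷ pre) w
visit-time-here≢there {x = x} {w} {pre} x∉ w∈ eq = <-irrefl (begin
  visit-time pre w        ≡⟨ visit-time-there x∉ w∈ ⟨
  visit-time (x ∷ pre) w  ≡⟨ eq ⟨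
  visit-time (x ∷ pre) x  ≡⟨ visit-time-here x pre ⟩
  length pre              ∎) (visit-time<length w∈)
  where open ≡-Reasoning

visit-time-injective : ∀ {n} {s : List (Fin n)} {u w} → Unique s → u ∈ s → w ∈ s →
                       visit-time s u ≡ visit-time s w → u ≡ w
visit-time-injective _           (here refl) (here refl) _  = refl
visit-time-injective (x∉ ∷ _)    (here refl) (there w∈)  eq = contradiction eq (visit-time-here≢there x∉ w∈)
visit-time-injective (x∉ ∷ _)    (there u∈)  (here refl) eq =
  contradiction (sym eq) (visit-time-here≢there x∉ u∈)
visit-time-injective (x∉ ∷ uniq) (there u∈)  (there w∈)  eq =
  visit-time-injective uniq u∈ w∈
    (trans (sym (visit-time-there x∉ u∈)) (trans eq (visit-time-there x∉ w∈)))

module _ {n} (G : Graph n) where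

  EntersSearch : Fin n → List (Fin n) → Set
  EntersSearch x pre = Any (λ y → Adj G y x) pre ⊎ (∀ {y} → y ∈ pre → ¬ Connected G y x)

  data SearchOrder : List (Fin n) → Set where
    []  : SearchOrder []
    _∷_ : ∀ {x pre} → EntersSearch x pre → SearchOrder pre → SearchOrder (x ∷ pre)

  search-earlier-neighbour-or-least :
    ∀ {s v} → SearchOrder s → Unique s → v ∈ s →
    (∃ λ y → y ∈ s × Adj G y v × visit-time s y < visit-time s v) ⊎
    (∀ {w} → w ∈ s → Connected G w v → visit-time s v ≤ visit-time s w)
  search-earlier-neighbour-or-least {x ∷ pre} (inj₁ adjacent ∷ _) (x∉ ∷ _) (here refl)
    with y , y∈ , y~x ← find adjacent = inj₁ (y , there y∈ , y~x , (begin-strict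
      visit-time (x ∷ pre) y  ≡⟨ visit-time-there x∉ y∈ ⟩
      visit-time pre y        <⟨ visit-time<length y∈ ⟩
      length pre              ≡⟨ visit-time-here x pre ⟨
      visit-time (x ∷ pre) x  ∎))
    where open ≤-Reasoning
  search-earlier-neighbour-or-least {x ∷ pre} (inj₂ new ∷ _) _ (here refl) = inj₂ λ
    { (here refl) _   → ≤-refl
    ; (there w∈)  w~x → contradiction w~x (new w∈) }
  search-earlier-neighbour-or-least {x ∷ pre} {v} (_ ∷ order) (x∉ ∷ uniq) (there v∈)
    rewrite visit-time-there x∉ v∈
    with search-earlier-neighbour-or-least order uniq v∈
  ... | inj₁ (y , y∈ , y~v , y<v) =
    inj₁ (y , there y∈ , y~v , subst (_< visit-time pre v) (sym (visit-time-there x∉ y∈)) y<v)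
  ... | inj₂ least = inj₂ λ
    { (here refl) _   →
        subst (visit-time pre v ≤_) (sym (visit-time-here x pre)) (<⇒≤ (visit-time<length v∈))
    ; (there w∈)  w~v → subst (visit-time pre v ≤_) (sym (visit-time-there x∉ w∈)) (least w∈ w~v) }

  open import Data.List.Membership.DecPropositional (_≟_ {n}) using (_∈?_)

  extend-search : ∀ s → (∀ v → v ∈ s) ⊎ ∃ λ x → x ∉ s × EntersSearch x s
  extend-search s with Finₚ.any? (λ x → ¬? (x ∈? s) ×-dec any? (λ y → T? (adj G y x)) s)
  ... | yes (x , x∉ , adjacent) = inj₂ (x , x∉ , inj₁ adjacent)
  ... | no no-edge-out with Finₚ.any? (λ x → ¬? (x ∈? s))
  ...   | no all∈ = inj₁ λ v → decidable-stable (v ∈? s) (λ v∉ → all∈ (v , v∉))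
  ...   | yes (x , x∉) = inj₂ (x , x∉ , inj₂ unreachable)
    where
    unreachable : ∀ {y} → y ∈ s → ¬ Connected G y x
    unreachable y∈ path with _ , d , c∈ , d∉ , c~d ← exit-edge (_∈? s) path y∈ x∉ =
      no-edge-out (d , d∉ , lose c∈ c~d)

  partial-search : ∀ k → ∃ λ s → Unique s × SearchOrder s × (k ≤ length s ⊎ (∀ v → v ∈ s))
  partial-search zero = [] , [] , [] , inj₁ z≤n
  partial-search (suc k) with partial-search k
  ... | s , uniq , order , inj₂ all∈ = s , uniq , order , inj₂ all∈
  ... | s , uniq , order , inj₁ k≤ with extend-search s
  ...   | inj₁ all∈             = s , uniq , order , inj₂ all∈
  ...   | inj₂ (x , x∉ , entry) = x ∷ s , ¬Any⇒All¬ s x∉ ∷ uniq , entry ∷ order , inj₁ (s≤s k≤)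

  complete-search : ∃ λ s → Unique s × SearchOrder s × (∀ v → v ∈ s)
  complete-search with partial-search (suc n)
  ... | s , uniq , order , inj₂ all∈  = s , uniq , order , all∈
  ... | s , uniq , order , inj₁ n<len = contradiction (unique⇒length≤ uniq) (<⇒≱ n<len)

record ConnectedOrdering {n} (G : Graph n) : Set where
  field
    rank                       : Fin n → ℕ
    rank-injective             : ∀ {u w} → rank u ≡ rank w → u ≡ w
    earlier-neighbour-or-least : ∀ v → (∃ λ y → Adj G y v × rank y < rank v) ⊎
                                       (∀ {w} → Connected G w v → rank v ≤ rank w)

connectedOrdering : ∀ {n} (G : Graph n) → ConnectedOrdering G
connectedOrdering G with s , uniq , order , all∈ ← complete-search G = record
  { rank                       = visit-time s
  ; rank-injective             = visit-time-injective uniq (all∈ _) (all∈ _)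
  ; earlier-neighbour-or-least = λ v → Sum.map (λ (y , _ , y~v , y<v) → y , y~v , y<v)
                                               (λ least {w} → least (all∈ w))
                                               (search-earlier-neighbour-or-least G order uniq (all∈ v))
  }

adj-sym : ∀ {n} (G : Graph n) {u v} → Adj G u v → Adj G v u
adj-sym G {u} {v} = subst T (Graph.sym G u v)

adj-irrefl : ∀ {n} (G : Graph n) {v} → ¬ Adj G v v
adj-irrefl G {v} = subst T (Graph.irrefl G v)

connected-sym : ∀ {n} (G : Graph n) {u v} → Connected G u v → Connected G v u
connected-sym G = Star.reverse (adj-sym G)

neighbours-injection : ∀ {n} (G : Graph n) v k → k < degree G v →
                       Σ (Fin (suc k) → Fin n) λ f →
                         (∀ i j → f i ≡ f j → i ≡ j) × (∀ i → Adj G v (f i))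
neighbours-injection {n} G v k k<deg =
  f , (λ i j eq → Finₚ.inject≤-injective k<deg k<deg i j (unique⇒lookup-injective unique _ _ eq)) , adjacent
  where
  neighbour? : ∀ u → Dec (adj G v u ≡ true)
  neighbour? u = adj G v u Bool.≟ true
  neighbours : List (Fin n)
  neighbours = filter neighbour? (allFin n)
  unique : Unique neighbours
  unique = Unique.filter⁺ neighbour? (Unique.allFin⁺ n)
  f : Fin (suc k) → Fin n
  f i = lookup neighbours (inject≤ i k<deg)
  adjacent : ∀ i → Adj G v (f i)
  adjacent i =
    subst T (sym (proj₂ (∈-filter⁻ neighbour? {xs = allFin n} (∈-lookup (inject≤ i k<deg))))) _

module LatestNeighbourForest {n} {G : Graph n} (ordering : ConnectedOrdering G) where

  open ConnectedOrdering ordering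

  EarlierNeighbour : Fin n → Fin n → Set
  EarlierNeighbour v u = Adj G u v × rank u < rank v

  EarlierNeighbour? : ∀ v u → Dec (EarlierNeighbour v u)
  EarlierNeighbour? v u = T? (adj G u v) ×-dec rank u <? rank v

  Parent : Fin n → Fin n → Set
  Parent v p = EarlierNeighbour v p × (∀ w → EarlierNeighbour v w → rank w ≤ rank p)

  Parent? : ∀ v p → Dec (Parent v p)
  Parent? v p =
    EarlierNeighbour? v p ×-dec Finₚ.all? (λ w → EarlierNeighbour? v w →-dec rank w ≤? rank p)

  parent-lower : ∀ {c p} → Parent c p → rank p < rank c
  parent-lower ((_ , p<c) , _) = p<c

  parent-unique : ∀ {c p q} → Parent c p → Parent c q → p ≡ q
  parent-unique (c→p , p-latest) (c→q , q-latest) =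
    rank-injective (≤-antisym (q-latest _ c→p) (p-latest _ c→q))

  parent-exists : ∀ {v w} → EarlierNeighbour v w → ∃ (Parent v)
  parent-exists {v} {w} v→w = p , earlier , latest
    where
    candidates : List (Fin n)
    candidates = filter (EarlierNeighbour? v) (allFin n)
    p : Fin n
    p = argmax rank w candidates
    earlier : EarlierNeighbour v p
    earlier = argmax-all rank v→w (all-filter (EarlierNeighbour? v) (allFin n))
    latest : ∀ u → EarlierNeighbour v u → rank u ≤ rank p
    latest u v→u =
      All.lookup (f[xs]≤f[argmax] w candidates) (∈-filter⁺ (EarlierNeighbour? v) (∈-allFin u) v→u)

  isParent : Fin n → Fin n → Bool
  isParent c p = isYes (Parent? c p)

  F : Graph n
  F = record
    { adj    = λ u v → isParent u v ∨ isParent v u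
    ; sym    = λ u v → ∨-comm (isParent u v) (isParent v u)
    ; irrefl = λ v → trans (∨-idem (isParent v v))
                     (trans (isYes≗does (Parent? v v))
                            (dec-false (Parent? v v) (<-irrefl refl ∘ parent-lower)))
    }

  F-adj⇒parent : ∀ {u v} → Adj F u v → Parent u v ⊎ Parent v u
  F-adj⇒parent {u} {v} =
    Sum.map (toWitness {a? = Parent? u v}) (toWitness {a? = Parent? v u}) ∘ Equivalence.to T-∨

  parent⇒F-adj : ∀ {u v} → Parent u v ⊎ Parent v u → Adj F u v
  parent⇒F-adj {u} {v} =
    Equivalence.from T-∨ ∘ Sum.map (fromWitness {a? = Parent? u v}) (fromWitness {a? = Parent? v u})

  F⊆G : Subgraph F G
  F⊆G u v a with F-adj⇒parent a
  ... | inj₁ ((v~u , _) , _) = adj-sym G v~u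
  ... | inj₂ ((u~v , _) , _) = u~v

  F-forest : Forest F
  F-forest (v , vs , 2≤len , uniq , walk) =
    parent-edges-acyclic v vs 2≤len uniq (Linked.map F-adj⇒parent walk)
    where open ParentGraph Parent rank parent-lower parent-unique

  Root : Fin n → Set
  Root z = ∀ w → ¬ EarlierNeighbour z w

  reach-root : ∀ v → Acc (_<_ on rank) v → ∃ λ z → Root z × Connected F v z
  reach-root v (acc lower) with Finₚ.any? (Parent? v)
  ... | yes (p , v→p) with z , root , p⇝z ← reach-root p (lower (parent-lower v→p)) =
    z , root , parent⇒F-adj (inj₁ v→p) ◅ p⇝z
  ... | no orphan = v , (λ w v→w → orphan (parent-exists v→w)) , ε

  root-least : ∀ {z w} → Root z → Connected G w z → rank z ≤ rank w
  root-least {z} root w⇝z with earlier-neighbour-or-least z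
  ... | inj₁ (y , y~z , y<z) = contradiction (y~z , y<z) (root y)
  ... | inj₂ least          = least w⇝z

  F-connected⇒G-connected : ∀ {u w} → Connected F u w → Connected G u w
  F-connected⇒G-connected = Star.map (F⊆G _ _)

  root-of : ∀ v → ∃ λ z → Root z × Connected F v z
  root-of v = reach-root v (On.wellFounded rank <-wellFounded v)

  -- Both endpoints reach roots that are rank-least in their common component, hence equal.
  G-connected⇒F-connected : ∀ {u w} → Connected G u w → Connected F u w
  G-connected⇒F-connected {u} {w} u⇝w with root-of u | root-of w
  ... | zu , root-u , u⇝zu | zw , root-w , w⇝zw =
    u⇝zu ◅◅ subst (λ z → Connected F z w) (sym zu≡zw) (connected-sym F w⇝zw)
    where
    zu⇝zw : Connected G zu zw
    zu⇝zw = connected-sym G (F-connected⇒G-connected u⇝zu) ◅◅ u⇝w ◅◅ F-connected⇒G-connected w⇝zw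
    zu≡zw : zu ≡ zw
    zu≡zw = rank-injective (≤-antisym (root-least root-u (connected-sym G zu⇝zw))
                                      (root-least root-w zu⇝zw))

  later-sibling-not-adjacent : ∀ {c₁ c₂ v} → Parent c₁ v → Parent c₂ v → rank c₁ < rank c₂ →
                               ¬ Adj G c₁ c₂
  later-sibling-not-adjacent c₁→v (_ , v-latest) c₁<c₂ c₁~c₂ =
    <-irrefl refl (<-≤-trans (parent-lower c₁→v) (v-latest _ (c₁~c₂ , c₁<c₂)))

  siblings-independent : ∀ {c₁ c₂ v} → Parent c₁ v → Parent c₂ v → ¬ Adj G c₁ c₂
  siblings-independent {c₁} {c₂} c₁→v c₂→v with <-cmp (rank c₁) (rank c₂)
  ... | tri< c₁<c₂ _ _ = later-sibling-not-adjacent c₁→v c₂→v c₁<c₂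
  ... | tri≈ _ c₁≈c₂ _ = subst (λ c → ¬ Adj G c₁ c) (rank-injective c₁≈c₂) (adj-irrefl G)
  ... | tri> _ _ c₂<c₁ = later-sibling-not-adjacent c₂→v c₁→v c₂<c₁ ∘ adj-sym G

  children-injection : ∀ {v k} (f : Fin (suc k) → Fin n) → (∀ i j → f i ≡ f j → i ≡ j) →
                       (∀ i → Adj F v (f i)) →
                       Σ (Fin k → Fin n) λ g →
                         (∀ i j → g i ≡ g j → i ≡ j) × (∀ i → Parent (g i) v)
  children-injection {v} {k} f f-inj adjacent = g , g-inj , child
    where
    parent-index : ∃ λ k₀ → ∀ j → j ≢ k₀ → ¬ Parent v (f j)
    parent-index with Finₚ.any? (λ i → Parent? v (f i))
    ... | yes (k₀ , v→fk₀) = k₀ , λ j j≢k₀ v→fj → j≢k₀ (f-inj j k₀ (parent-unique v→fj v→fk₀))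
    ... | no  orphan       = Fin.zero , λ j _ v→fj → orphan (j , v→fj)
    k₀ : Fin (suc k)
    k₀ = proj₁ parent-index
    g : Fin k → Fin n
    g i = f (punchIn k₀ i)
    g-inj : ∀ i j → g i ≡ g j → i ≡ j
    g-inj i j eq = Finₚ.punchIn-injective k₀ i j (f-inj _ _ eq)
    child : ∀ i → Parent (g i) v
    child i with F-adj⇒parent (adjacent (punchIn k₀ i))
    ... | inj₁ v→gi = contradiction v→gi (proj₂ parent-index _ (Finₚ.punchInᵢ≢i k₀ i))
    ... | inj₂ gi→v = gi→v

  F-degree≤ : ∀ {Δ} → ¬ InducedStar G Δ → ∀ v → degree F v ≤ Δ
  F-degree≤ {Δ} no-star v with degree F v ≤? Δ
  ... | yes ≤Δ = ≤Δ
  ... | no  ≰Δ with f , f-inj , adjacent ← neighbours-injection F v Δ (≰⇒> ≰Δ)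
               with g , g-inj , child ← children-injection f f-inj adjacent =
    contradiction (v , g , g-inj , (λ i → proj₁ (proj₁ (child i))) ,
                   (λ i j → siblings-independent (child i) (child j)))
                  no-star

  F-spanning : ∀ {Δ} → ¬ InducedStar G Δ → SpanningΔForest Δ G F
  F-spanning no-star =
    (F⊆G , F-forest , λ _ _ → mk⇔ G-connected⇒F-connected F-connected⇒G-connected) , F-degree≤ no-star

lemma1p8 : (Δ : ℕ) → 1 ≤ Δ → (n : ℕ) → (G : Graph n) →
    ¬ InducedStar G Δ → Σ (Graph n) (λ F → SpanningΔForest Δ G F)
lemma1p8 Δ _ n G no-star = F , F-spanning no-star
  where open LatestNeighbourForest (connectedOrdering G)
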